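{- Let $T$ be a tree, let $v$ be a vertex of $T$ with $\deg v\ge 2$, let $V_1,\ldots,V_k$ be the vertex sets of the connected components of $T-v$, and let $T_i=T[V_i\cup\{v\}]$ for $1\le i\le k$. Partition the indices $1,\ldots,k$ into \begin{align*} I&=\{i:\gamma_P(T_i;\{v\})=\gamma_P(T_i) \text{ and } 1+\gamma_P(T_i-v)\neq\gamma_P(T_i;\{v\})\},\\ I'&=\{i:\gamma_P(T_i;\{v\})=\gamma_P(T_i) \text{ and } 1+\gamma_P(T_i-v)=\gamma_P(T_i;\{v\})\},\\ J&=\{i:\gamma_P(T_i;\{v\})\neq\gamma_P(T_i)\}. \end{align*} Let $g=-k+\sum_{i=1}^k\gamma_P(T_i;\{v\})$. Then \[\gamma_P(T)=\begin{cases} g+1 & \text{if } |I|\ge 2 \text{ or } |J|=0,\\ g & \text{if } |I|\le 1 \text{ and } |J|\ge 1.\end{cases}\]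
   Context: All graphs are finite, simple and undirected. $H[W]$ denotes the subgraph induced by $W$, and $H-v$ the graph obtained by deleting $v$. $N(v)$ denotes the set of neighbors of $v$, $N[v]=N(v)\cup\{v\}$, $N[S]=\bigcup_{v\in S}N[v]$. For $S\subseteq V$, the set $PD(S)$ is defined by: initially $PD(S)=N[S]$; while there exists $v\in PD(S)$ with $|N(v)\setminus PD(S)|=1$, replace $PD(S)$ by $PD(S)\cup N(v)$. $S$ is a power dominating set of $G$ if at the end $PD(S)=V(G)$. $\gamma_P(G)$ is the minimum cardinality of a power dominating set of $G$, and for $X\subseteq V(G)$, $\gamma_P(G;X)$ is the minimum cardinality of a power dominating set of $G$ containing $X$. -}

module Defs where

open import Data.Nat using (ℕ; zero; suc; _+_; _≤_; _≟_)
open import Data.Bool using (Bool; true; false; not; _∧_)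
open import Data.Fin using (Fin)
import Data.Fin as F
open import Data.Fin.Subset using (Subset; _∈_; _∉_; _⊆_; ∣_∣; ⊤; ⊥; ⁅_⁆; _∪_)
open import Data.Vec using (tabulate)
import Data.Vec as V
open import Data.List using (List; []; _∷_; _++_; [_]; length)
open import Data.List.Relation.Unary.Unique.Propositional using (Unique)
open import Data.List.Relation.Unary.Linked using (Linked)
open import Data.Empty renaming (⊥ to Empty)
open import Data.Product using (Σ; _×_; _,_)
open import Relation.Nullary using (¬_; does)
open import Relation.Binary.PropositionalEquality using (_≡_; _≢_)

record Graph (n : ℕ) : Set where
  field
    adj    : Fin n → Fin n → Bool
    sym    : ∀ u w → adj u w ≡ adj w u
    irrefl : ∀ u → adj u u ≡ false

module _ {n : ℕ} (G : Graph n) where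
  open Graph G

  E : Fin n → Fin n → Set
  E u w = adj u w ≡ true

  deg : Fin n → ℕ
  deg v = ∣ tabulate (λ u → adj v u) ∣

  data Reach (W : Subset n) : Fin n → Fin n → Set where
    here : ∀ {u} → u ∈ W → Reach W u u
    step : ∀ {u w x} → u ∈ W → E u w → Reach W w x → Reach W u x

  IsCycle : List (Fin n) → Set
  IsCycle []       = Empty
  IsCycle (x ∷ xs) = Unique (x ∷ xs) × 3 ≤ length (x ∷ xs) × Linked E (x ∷ xs ++ [ x ])

  IsTree : Set
  IsTree = (∀ u w → Reach ⊤ u w) × (¬ Σ (List (Fin n)) IsCycle)

  -- the set PD(S) computed in the induced subgraph G[W]:
  -- the least set containing N[S] (within W) and closed under the
  -- propagation rule "if u ∈ PD(S) has exactly one neighbour w (in W)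
  -- outside PD(S), add w".
  data Observed (W S : Subset n) : Fin n → Set where
    dom  : ∀ {u} → u ∈ S → Observed W S u
    nbr  : ∀ {u w} → u ∈ S → w ∈ W → E u w → Observed W S w
    prop : ∀ {u w} → u ∈ W → Observed W S u → w ∈ W → E u w →
           (∀ x → x ∈ W → E u x → x ≢ w → Observed W S x) →
           Observed W S w

  PowerDom : Subset n → Subset n → Set
  PowerDom W S = S ⊆ W × (∀ u → u ∈ W → Observed W S u)

  -- γ_P(G[W]; X) = m
  IsGammaP : Subset n → Subset n → ℕ → Set
  IsGammaP W X m =
    Σ (Subset n) (λ S → X ⊆ S × PowerDom W S × ∣ S ∣ ≡ m) ×
    (∀ S → X ⊆ S → PowerDom W S → m ≤ ∣ S ∣)

allBut : ∀ {n} → Fin n → Subset n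
allBut v = tabulate (λ u → not (does (u F.≟ v)))

classOf : ∀ {n k} → Fin n → (Fin n → Fin k) → Fin k → Subset n
classOf v c i = tabulate (λ u → not (does (u F.≟ v)) ∧ does (c u F.≟ i))

setI : ∀ {k} → (a b c : Fin k → ℕ) → Subset k
setI a b c = tabulate (λ i → does (a i ≟ b i) ∧ not (does (suc (c i) ≟ a i)))

setJ : ∀ {k} → (a b : Fin k → ℕ) → Subset k
setJ a b = tabulate (λ i → not (does (a i ≟ b i)))

sumF : ∀ {k} → (Fin k → ℕ) → ℕ
sumF a = V.sum (tabulate a)

-- Let S be a minimum power dominating set of T and s i = ∣ S ∩ V i ∣. Adding v to S ∩ V i gives
-- a power dominating set of T_i containing v, so a i ≤ s i + 1 and Σ a ≤ m + k. The inequality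
-- is strict unless v ∉ S and s i = a i - 1 for all i; but then, following the propagation of S
-- through v, some S ∩ V i power dominates T_i (so J ≠ ∅), and all S ∩ V i but one power
-- dominate T_i - v (so ∣I∣ ≤ 1).
-- Conversely, v together with the optimal sets of the T_i with v removed power dominates T, so
-- m + k ≤ Σ a + 1. When ∣I∣ ≤ 1 and J ≠ ∅, v can be dropped: take minimum power dominating
-- sets of T_i for i ∈ J (size b i < a i) and of T_i - v for i ∈ I' (size d i = a i - 1). The
-- former observe v, hence all of the T_i - v with i ∈ I'; then v propagates to the root of the
-- single component in I, which is finished from its optimal set minus v.
module Submission where

open import Defs
open import Data.Nat using (ℕ; zero; suc; _+_; _≤_; _<_; _≟_; z≤n; s≤s)
open import Data.Nat.Properties
open import Algebra.Properties.CommutativeSemigroup +-commutativeSemigroup using (x∙yz≈y∙xz)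
open import Data.Bool using (Bool; true; not; _∧_)
open import Data.Bool.Properties using (∧-conicalˡ; ∧-conicalʳ)
open import Data.Fin using (Fin; zero; suc)
import Data.Fin.Properties as FinP
open import Data.Fin.Subset
  using (Subset; inside; outside; ∣_∣; ⊤; ⊥; ⁅_⁆; _∪_; _∩_; _-_; _∈_; _∉_; _⊆_; Nonempty)
open import Data.Fin.Subset.Properties
open import Data.Vec using ([]; _∷_; tabulate; here; there)
open import Data.Vec.Properties using ([]=⇒lookup; lookup⇒[]=; lookup∘tabulate)
open import Data.Product using (Σ; ∃; _×_; _,_; proj₁; proj₂)
import Data.Product as Product
open import Data.Sum using (_⊎_; inj₁; inj₂)
open import Function using (_∘_; id)
open import Function.Bundles using (_⇔_; Equivalence)
open import Data.List using (List; []; _∷_; _++_; [_]; length)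
open import Data.List.Relation.Unary.All using (All; []; _∷_)
import Data.List.Relation.Unary.All as All
open import Data.List.Relation.Unary.Any using (here; there)
open import Data.List.Relation.Unary.All.Properties.Core using (¬Any⇒All¬)
open import Data.List.Relation.Unary.AllPairs using ([]; _∷_)
open import Data.List.Relation.Unary.Unique.Propositional using (Unique)
open import Data.List.Relation.Unary.Linked using (Linked; []; [-]; _∷_)
open import Data.Empty using () renaming (⊥ to Empty)
open import Relation.Nullary using (¬_; Dec; does; yes; no; contradiction)
open import Relation.Nullary.Decidable using (dec-true; dec-false)
open import Relation.Binary.PropositionalEquality hiding ([_])

private
  variable
    n k : ℕ

∣p∪q∣+∣p∩q∣≡∣p∣+∣q∣ : (p q : Subset n) → ∣ p ∪ q ∣ + ∣ p ∩ q ∣ ≡ ∣ p ∣ + ∣ q ∣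
∣p∪q∣+∣p∩q∣≡∣p∣+∣q∣ []            []            = refl
∣p∪q∣+∣p∩q∣≡∣p∣+∣q∣ (outside ∷ p) (outside ∷ q) = ∣p∪q∣+∣p∩q∣≡∣p∣+∣q∣ p q
∣p∪q∣+∣p∩q∣≡∣p∣+∣q∣ (inside  ∷ p) (outside ∷ q) = cong suc (∣p∪q∣+∣p∩q∣≡∣p∣+∣q∣ p q)
∣p∪q∣+∣p∩q∣≡∣p∣+∣q∣ (outside ∷ p) (inside  ∷ q) =
  trans (cong suc (∣p∪q∣+∣p∩q∣≡∣p∣+∣q∣ p q)) (sym (+-suc ∣ p ∣ ∣ q ∣))
∣p∪q∣+∣p∩q∣≡∣p∣+∣q∣ (inside  ∷ p) (inside  ∷ q) = cong suc (begin
  ∣ p ∪ q ∣ + suc ∣ p ∩ q ∣ ≡⟨ +-suc ∣ p ∪ q ∣ ∣ p ∩ q ∣ ⟩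
  suc (∣ p ∪ q ∣ + ∣ p ∩ q ∣) ≡⟨ cong suc (∣p∪q∣+∣p∩q∣≡∣p∣+∣q∣ p q) ⟩
  suc (∣ p ∣ + ∣ q ∣)         ≡⟨ +-suc ∣ p ∣ ∣ q ∣ ⟨
  ∣ p ∣ + suc ∣ q ∣           ∎)
  where open ≡-Reasoning

∣p∪q∣≤∣p∣+∣q∣ : (p q : Subset n) → ∣ p ∪ q ∣ ≤ ∣ p ∣ + ∣ q ∣
∣p∪q∣≤∣p∣+∣q∣ p q = ≤-trans (m≤m+n ∣ p ∪ q ∣ ∣ p ∩ q ∣) (≤-reflexive (∣p∪q∣+∣p∩q∣≡∣p∣+∣q∣ p q))

∣p∪⁅x⁆∣≤1+∣p∣ : (p : Subset n) (x : Fin n) → ∣ p ∪ ⁅ x ⁆ ∣ ≤ suc ∣ p ∣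
∣p∪⁅x⁆∣≤1+∣p∣ p x = ≤-trans (∣p∪q∣≤∣p∣+∣q∣ p ⁅ x ⁆)
  (≤-reflexive (trans (cong (∣ p ∣ +_) (∣⁅x⁆∣≡1 x)) (+-comm ∣ p ∣ 1)))

∣p∪q∣≡∣p∣+∣q∣ : (p q : Subset n) → (∀ {x} → x ∈ p → x ∉ q) → ∣ p ∪ q ∣ ≡ ∣ p ∣ + ∣ q ∣
∣p∪q∣≡∣p∣+∣q∣ {n} p q disjoint = begin
  ∣ p ∪ q ∣               ≡⟨ +-identityʳ ∣ p ∪ q ∣ ⟨
  ∣ p ∪ q ∣ + 0           ≡⟨ cong (∣ p ∪ q ∣ +_) ∣p∩q∣≡0 ⟨
  ∣ p ∪ q ∣ + ∣ p ∩ q ∣   ≡⟨ ∣p∪q∣+∣p∩q∣≡∣p∣+∣q∣ p q ⟩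
  ∣ p ∣ + ∣ q ∣           ∎
  where
  open ≡-Reasoning
  p∩q⊆⊥ : p ∩ q ⊆ ⊥
  p∩q⊆⊥ x∈p∩q = contradiction (proj₂ (x∈p∩q⁻ p q x∈p∩q)) (disjoint (proj₁ (x∈p∩q⁻ p q x∈p∩q)))
  ∣p∩q∣≡0 : ∣ p ∩ q ∣ ≡ 0
  ∣p∩q∣≡0 = n≤0⇒n≡0 (≤-trans (p⊆q⇒∣p∣≤∣q∣ p∩q⊆⊥) (≤-reflexive (∣⊥∣≡0 n)))

x∈p⇒0<∣p∣ : ∀ {x} {p : Subset n} → x ∈ p → 0 < ∣ p ∣
x∈p⇒0<∣p∣ x∈p = ≤-trans (s≤s z≤n) (x∈p⇒∣p-x∣<∣p∣ x∈p)

0<∣p∣⇒Nonempty : ∀ {p : Subset n} → 0 < ∣ p ∣ → Nonempty p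
0<∣p∣⇒Nonempty {p = inside  ∷ p} _      = zero , here
0<∣p∣⇒Nonempty {p = outside ∷ p} 0<∣p∣ = Product.map suc there (0<∣p∣⇒Nonempty 0<∣p∣)

∣p∣≤1⇒∈-unique : ∀ {x y} {p : Subset n} → ∣ p ∣ ≤ 1 → x ∈ p → y ∈ p → x ≡ y
∣p∣≤1⇒∈-unique {x = x} {y} ∣p∣≤1 x∈p y∈p with y FinP.≟ x
... | yes y≡x = sym y≡x
... | no  y≢x = contradiction (≤-trans 2≤∣p∣ ∣p∣≤1) λ { (s≤s ()) }
  where
  2≤∣p∣ : 2 ≤ _
  2≤∣p∣ = ≤-trans (s≤s (x∈p⇒0<∣p∣ (x∈p∧x≢y⇒x∈p-y y∈p y≢x))) (x∈p⇒∣p-x∣<∣p∣ x∈p)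

∈-unique⇒∣p∣≤1 : ∀ {p : Subset n} → (∀ {x y} → x ∈ p → y ∈ p → x ≡ y) → ∣ p ∣ ≤ 1
∈-unique⇒∣p∣≤1 {n} {p} unique with nonempty? p
... | no ¬ne = ≤-trans (≤-reflexive (trans (cong ∣_∣ (Empty-unique ¬ne)) (∣⊥∣≡0 n))) z≤n
... | yes (x , x∈p) = ≤-trans (p⊆q⇒∣p∣≤∣q∣ p⊆⁅x⁆) (≤-reflexive (∣⁅x⁆∣≡1 x))
  where
  p⊆⁅x⁆ : p ⊆ ⁅ x ⁆
  p⊆⁅x⁆ y∈p = subst (_∈ ⁅ x ⁆) (unique x∈p y∈p) (x∈⁅x⁆ x)

∈-tabulate⁺ : ∀ {x} {f : Fin n → Bool} → f x ≡ true → x ∈ tabulate f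
∈-tabulate⁺ {x = x} {f} fx≡true = lookup⇒[]= x (tabulate f) (trans (lookup∘tabulate f x) fx≡true)

∈-tabulate⁻ : ∀ {x} {f : Fin n → Bool} → x ∈ tabulate f → f x ≡ true
∈-tabulate⁻ {x = x} {f} x∈f = trans (sym (lookup∘tabulate f x)) ([]=⇒lookup x∈f)

⋃ᶠ : (Fin k → Subset n) → Subset n
⋃ᶠ {k = zero}  F = ⊥
⋃ᶠ {k = suc k} F = F zero ∪ ⋃ᶠ (F ∘ suc)

∈⋃ᶠ⁺ : ∀ {x} (F : Fin k → Subset n) i → x ∈ F i → x ∈ ⋃ᶠ F
∈⋃ᶠ⁺ F zero    x∈F = x∈p∪q⁺ (inj₁ x∈F)
∈⋃ᶠ⁺ F (suc i) x∈F = x∈p∪q⁺ (inj₂ (∈⋃ᶠ⁺ (F ∘ suc) i x∈F))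

∈⋃ᶠ⁻ : ∀ {x} (F : Fin k → Subset n) → x ∈ ⋃ᶠ F → ∃ λ i → x ∈ F i
∈⋃ᶠ⁻ {k = zero}  F x∈⋃ = contradiction x∈⋃ ∉⊥
∈⋃ᶠ⁻ {k = suc k} F x∈⋃ with x∈p∪q⁻ (F zero) (⋃ᶠ (F ∘ suc)) x∈⋃
... | inj₁ x∈F₀ = zero , x∈F₀
... | inj₂ x∈⋃′ = Product.map suc id (∈⋃ᶠ⁻ (F ∘ suc) x∈⋃′)

∣⋃ᶠ∣≤sumF : (F : Fin k → Subset n) → ∣ ⋃ᶠ F ∣ ≤ sumF (∣_∣ ∘ F)
∣⋃ᶠ∣≤sumF {k = zero}  {n} F = ≤-reflexive (∣⊥∣≡0 n)
∣⋃ᶠ∣≤sumF {k = suc k} F =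
  ≤-trans (∣p∪q∣≤∣p∣+∣q∣ (F zero) _) (+-monoʳ-≤ ∣ F zero ∣ (∣⋃ᶠ∣≤sumF (F ∘ suc)))

∣⋃ᶠ∣≡sumF : (F : Fin k → Subset n) → (∀ {i j x} → x ∈ F i → x ∈ F j → i ≡ j) →
            ∣ ⋃ᶠ F ∣ ≡ sumF (∣_∣ ∘ F)
∣⋃ᶠ∣≡sumF {k = zero}  {n} F _ = ∣⊥∣≡0 n
∣⋃ᶠ∣≡sumF {k = suc k} F disjoint =
  trans (∣p∪q∣≡∣p∣+∣q∣ (F zero) _ F₀-disjoint)
        (cong (∣ F zero ∣ +_) (∣⋃ᶠ∣≡sumF (F ∘ suc) (λ x∈Fᵢ x∈Fⱼ → FinP.suc-injective (disjoint x∈Fᵢ x∈Fⱼ))))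
  where
  F₀-disjoint : ∀ {x} → x ∈ F zero → x ∉ ⋃ᶠ (F ∘ suc)
  F₀-disjoint x∈F₀ x∈⋃ with () ← disjoint x∈F₀ (proj₂ (∈⋃ᶠ⁻ (F ∘ suc) x∈⋃))

sumF-mono-≤ : {a b : Fin k → ℕ} → (∀ i → a i ≤ b i) → sumF a ≤ sumF b
sumF-mono-≤ {k = zero}  a≤b = z≤n
sumF-mono-≤ {k = suc k} a≤b = +-mono-≤ (a≤b zero) (sumF-mono-≤ (a≤b ∘ suc))

sumF-mono-< : {a b : Fin k → ℕ} → (∀ i → a i ≤ b i) → ∀ j → a j < b j → sumF a < sumF b
sumF-mono-< a≤b zero    a₀<b₀ = +-mono-<-≤ a₀<b₀ (sumF-mono-≤ (a≤b ∘ suc))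
sumF-mono-< a≤b (suc j) aⱼ<bⱼ = +-mono-≤-< (a≤b zero) (sumF-mono-< (a≤b ∘ suc) j aⱼ<bⱼ)

sumF-suc : (a : Fin k → ℕ) → sumF (suc ∘ a) ≡ k + sumF a
sumF-suc {k = zero}  a = refl
sumF-suc {k = suc k} a =
  cong suc (trans (cong (a zero +_) (sumF-suc (a ∘ suc))) (x∙yz≈y∙xz (a zero) k (sumF (a ∘ suc))))

does⇒ : ∀ {P : Set} (p? : Dec P) → does p? ≡ true → P
does⇒ (yes p) _ = p
does⇒ (no _) ()

not-does⇒ : ∀ {P : Set} (p? : Dec P) → not (does p?) ≡ true → ¬ P
not-does⇒ (no ¬p) _ = ¬p
not-does⇒ (yes _) ()

module _ (G : Graph n) where
  open Graph G using (irrefl) renaming (sym to adj-sym)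
  open import Data.List.Membership.DecPropositional (FinP._≟_ {n}) using ()
    renaming (_∈_ to _∈ₗ_; _∈?_ to _∈ₗ?_)

  E-sym : ∀ {u w} → E G u w → E G w u
  E-sym {u} {w} e = trans (adj-sym w u) e

  E-irrefl : ∀ {u} → ¬ E G u u
  E-irrefl {u} e with () ← trans (sym e) (irrefl u)

  PropagationClosed : Subset n → (Fin n → Set) → Set
  PropagationClosed W P = ∀ {u w} → u ∈ W → P u → w ∈ W → E G u w →
                          (∀ x → x ∈ W → E G u x → x ≢ w → P x) → P w

  Observed-ind : ∀ {W S} (P : Fin n → Set) →
    (∀ {u} → u ∈ S → P u) →
    (∀ {u w} → u ∈ S → w ∈ W → E G u w → P w) →
    PropagationClosed W P →
    ∀ {u} → Observed G W S u → P u
  Observed-ind P dom-case nbr-case prop-case (dom u∈S)         = dom-case u∈S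
  Observed-ind P dom-case nbr-case prop-case (nbr u∈S w∈W e)   = nbr-case u∈S w∈W e
  Observed-ind P dom-case nbr-case prop-case (prop u∈W o w∈W e others) =
    prop-case u∈W (Observed-ind P dom-case nbr-case prop-case o) w∈W e
      (λ x x∈W ex x≢w → Observed-ind P dom-case nbr-case prop-case (others x x∈W ex x≢w))

  -- Path u x L: a walk from u to x whose vertices after u are, in order, L.
  data Path : Fin n → Fin n → List (Fin n) → Set where
    []  : ∀ {u} → Path u u []
    _∷_ : ∀ {u w x L} → E G u w → Path w x L → Path u x (w ∷ L)

  Path-suffix : ∀ {P : Fin n → Set} {u w x L} → u ∈ₗ w ∷ L → Path w x L →
    Unique (w ∷ L) → All P (w ∷ L) → ∃ λ L′ → Path u x L′ × Unique (u ∷ L′) × All P (u ∷ L′)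
  Path-suffix (here refl) p       unique       all       = _ , p , unique , all
  Path-suffix (there u∈L) (e ∷ p) (_ ∷ unique) (_ ∷ all) = Path-suffix u∈L p unique all

  Reach⇒Path : ∀ {W u x} → Reach G W u x →
    ∃ λ L → Path u x L × Unique (u ∷ L) × All (_∈ W) (u ∷ L)
  Reach⇒Path (here u∈W) = [] , [] , [] ∷ [] , u∈W ∷ []
  Reach⇒Path {u = u} (step {w = w} u∈W e r) with Reach⇒Path r
  ... | L , p , unique , all with u ∈ₗ? w ∷ L
  ...   | yes u∈L = Path-suffix u∈L p unique all
  ...   | no  u∉L = w ∷ L , e ∷ p , ¬Any⇒All¬ (w ∷ L) u∉L ∷ unique , u∈W ∷ all

  Path⇒Linked : ∀ {u x z L} → Path u x L → E G x z → Linked (E G) (u ∷ L ++ [ z ])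
  Path⇒Linked []      e  = e ∷ [-]
  Path⇒Linked (e ∷ p) e′ = e ∷ Path⇒Linked p e′

  Path-nonempty : ∀ {u x L} → u ≢ x → Path u x L → 1 ≤ length L
  Path-nonempty u≢x []      = contradiction refl u≢x
  Path-nonempty u≢x (_ ∷ _) = s≤s z≤n

  Path-between-neighbours⇒cycle : ∀ {w y y′ L} → E G w y → E G w y′ → y ≢ y′ → Path y y′ L →
    Unique (y ∷ L) → All (w ≢_) (y ∷ L) → IsCycle G (w ∷ y ∷ L)
  Path-between-neighbours⇒cycle e e′ y≢y′ p unique w∉L =
    w∉L ∷ unique , s≤s (s≤s (Path-nonempty y≢y′ p)) , e ∷ Path⇒Linked p (E-sym e′)

module Branches {n} (T : Graph n) (tree : IsTree T) (v : Fin n) {k} (c : Fin n → Fin k)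
  (c-onto : ∀ i → Σ (Fin n) (λ u → u ≢ v × c u ≡ i))
  (c-components : ∀ u w → u ≢ v → w ≢ v → (c u ≡ c w ⇔ Reach T (allBut v) u w)) where

  Obs : Subset n → Subset n → Fin n → Set
  Obs = Observed T

  PD : Subset n → Subset n → Set
  PD = PowerDom T

  -- W i and V i are the vertex sets of the paper's T_i and T_i - v.
  V W : Fin k → Subset n
  V i = classOf v c i
  W i = V i ∪ ⁅ v ⁆

  ∈V⁺ : ∀ {u i} → u ≢ v → c u ≡ i → u ∈ V i
  ∈V⁺ {u} {i} u≢v cu≡i =
    ∈-tabulate⁺ (cong₂ _∧_ (cong not (dec-false (u FinP.≟ v) u≢v)) (dec-true (c u FinP.≟ i) cu≡i))

  ∈V⁻ : ∀ {u i} → u ∈ V i → u ≢ v × c u ≡ i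
  ∈V⁻ {u} {i} u∈V =
    not-does⇒ (u FinP.≟ v) (∧-conicalˡ _ _ u∈V′) , does⇒ (c u FinP.≟ i) (∧-conicalʳ _ _ u∈V′)
    where u∈V′ = ∈-tabulate⁻ u∈V

  ∈V-own : ∀ {u} → u ≢ v → u ∈ V (c u)
  ∈V-own u≢v = ∈V⁺ u≢v refl

  V⊆W : ∀ {i} → V i ⊆ W i
  V⊆W = x∈p∪q⁺ ∘ inj₁

  v∈W : ∀ {i} → v ∈ W i
  v∈W = x∈p∪q⁺ (inj₂ (x∈⁅x⁆ v))

  ∈W⁻ : ∀ {u i} → u ∈ W i → u ∈ V i ⊎ u ≡ v
  ∈W⁻ {i = i} u∈W with x∈p∪q⁻ (V i) ⁅ v ⁆ u∈W
  ... | inj₁ u∈V = inj₁ u∈V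
  ... | inj₂ u∈⁅v⁆ = inj₂ (x∈⁅y⁆⇒x≡y v u∈⁅v⁆)

  ∈allBut⁺ : ∀ {u} → u ≢ v → u ∈ allBut v
  ∈allBut⁺ {u} u≢v = ∈-tabulate⁺ (cong not (dec-false (u FinP.≟ v) u≢v))

  ∈allBut⁻ : ∀ {u} → u ∈ allBut v → u ≢ v
  ∈allBut⁻ {u} u∈ = not-does⇒ (u FinP.≟ v) (∈-tabulate⁻ u∈)

  edge⇒same-component : ∀ {u w} → u ≢ v → w ≢ v → E T u w → c u ≡ c w
  edge⇒same-component {u} {w} u≢v w≢v e =
    Equivalence.from (c-components u w u≢v w≢v) (step (∈allBut⁺ u≢v) e (here (∈allBut⁺ w≢v)))

  V-neighbour∈W : ∀ {i u w} → u ∈ V i → E T u w → w ∈ W i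
  V-neighbour∈W {w = w} u∈V e with w FinP.≟ v
  ... | yes refl = v∈W
  ... | no w≢v   = let (u≢v , cu≡i) = ∈V⁻ u∈V in
                   V⊆W (∈V⁺ w≢v (trans (sym (edge⇒same-component u≢v w≢v e)) cu≡i))

  V-neighbour∈V : ∀ {i u w} → u ∈ V i → E T u w → w ≢ v → w ∈ V i
  V-neighbour∈V u∈V e w≢v with ∈W⁻ (V-neighbour∈W u∈V e)
  ... | inj₁ w∈V = w∈V
  ... | inj₂ w≡v = contradiction w≡v w≢v

  v-neighbour-in-component : ∀ {W′ u} → Reach T W′ u v → u ≢ v →
    Σ (Fin n) λ y → y ≢ v × c y ≡ c u × E T v y
  v-neighbour-in-component (here _) u≢v = contradiction refl u≢v
  v-neighbour-in-component {u = u} (step {w = w} _ e r) u≢v with w FinP.≟ v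
  ... | yes refl = u , u≢v , refl , E-sym T e
  ... | no  w≢v  = let (y , y≢v , cy≡cw , e′) = v-neighbour-in-component r w≢v in
                   y , y≢v , trans cy≡cw (sym (edge⇒same-component u≢v w≢v e)) , e′

  root-spec : ∀ i → Σ (Fin n) λ y → y ≢ v × c y ≡ i × E T v y
  root-spec i =
    let (u , u≢v , cu≡i) = c-onto i
        (y , y≢v , cy≡cu , e) = v-neighbour-in-component (proj₁ tree u v) u≢v
    in y , y≢v , trans cy≡cu cu≡i , e

  root : Fin k → Fin n
  root i = proj₁ (root-spec i)

  root-component : ∀ i → c (root i) ≡ i
  root-component i = proj₁ (proj₂ (proj₂ (root-spec i)))

  root-adj : ∀ i → E T v (root i)
  root-adj i = proj₂ (proj₂ (proj₂ (root-spec i)))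

  root∈V : ∀ i → root i ∈ V i
  root∈V i = ∈V⁺ (proj₁ (proj₂ (root-spec i))) (root-component i)

  -- A path inside one component between two neighbours of v would close a cycle through v.
  v-neighbours-same-component⇒≡ : ∀ {y y′} → y ≢ v → y′ ≢ v → E T v y → E T v y′ →
                                  c y ≡ c y′ → y ≡ y′
  v-neighbours-same-component⇒≡ {y} {y′} y≢v y′≢v e e′ cy≡cy′ with y FinP.≟ y′
  ... | yes y≡y′ = y≡y′
  ... | no  y≢y′ =
    let (L , p , unique , all) = Reach⇒Path T (Equivalence.to (c-components y y′ y≢v y′≢v) cy≡cy′)
        v∉L = All.map (λ u∈ → ≢-sym (∈allBut⁻ u∈)) all
    in contradiction (_ , Path-between-neighbours⇒cycle T e e′ y≢y′ p unique v∉L) (proj₂ tree)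

  v-neighbour≡root : ∀ {i y} → y ∈ W i → E T v y → y ≡ root i
  v-neighbour≡root {i} y∈W e with ∈W⁻ y∈W
  ... | inj₂ refl = contradiction e (E-irrefl T)
  ... | inj₁ y∈V  = let (y≢v , cy≡i) = ∈V⁻ y∈V in
    v-neighbours-same-component⇒≡ y≢v (proj₁ (∈V⁻ (root∈V i))) e (root-adj i)
      (trans cy≡i (sym (root-component i)))

  adjacent-to-v⇒root : ∀ {i u} → u ∈ W i → E T u v → u ≡ root i
  adjacent-to-v⇒root u∈W e = v-neighbour≡root u∈W (E-sym T e)

  observed-in-V⇒observed : ∀ {i D X S} → V i ⊆ X → D ⊆ S → Obs X S v →
                           ∀ {u} → Obs (V i) D u → Obs X S u
  observed-in-V⇒observed {i} {D} {X} {S} V⊆X D⊆S v-obs =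
    Observed-ind T (Obs X S) (dom ∘ D⊆S) (λ u∈D w∈V e → nbr (D⊆S u∈D) (V⊆X w∈V) e) prop-case
    where
    prop-case : PropagationClosed T (V i) (Obs X S)
    prop-case {u} {w} u∈V u-obs w∈V e others = prop (V⊆X u∈V) u-obs (V⊆X w∈V) e others′
      where
      others′ : ∀ x → x ∈ X → E T u x → x ≢ w → Obs X S x
      others′ x _ ex x≢w with ∈W⁻ (V-neighbour∈W u∈V ex)
      ... | inj₁ x∈V = others x x∈V ex x≢w
      ... | inj₂ refl = v-obs

  -- In T_i, v propagates only to root i, a step that is not valid in T; the invariant
  -- therefore carries that root i is observed in T as soon as v is.
  observed-in-W⇒observed : ∀ {i Sᵢ S} → Sᵢ ⊆ W i → (∀ {u} → u ∈ Sᵢ → u ≢ v → u ∈ S) →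
    (v ∈ Sᵢ → Obs ⊤ S v × Obs ⊤ S (root i)) → ∀ {u} → Obs (W i) Sᵢ u → Obs ⊤ S u
  observed-in-W⇒observed {i} {Sᵢ} {S} Sᵢ⊆W Sᵢ-v⊆S v∈Sᵢ⇒observed =
    proj₁ ∘ Observed-ind T P dom-case nbr-case prop-case
    where
    P : Fin n → Set
    P u = Obs ⊤ S u × (u ≡ v → Obs ⊤ S (root i))
    from-v : ∀ {w} → w ∈ W i → E T v w → Obs ⊤ S (root i) → P w
    from-v w∈W e root-obs =
      subst (Obs ⊤ S) (sym (v-neighbour≡root w∈W e)) root-obs ,
      λ { refl → contradiction e (E-irrefl T) }
    dom-case : ∀ {u} → u ∈ Sᵢ → P u
    dom-case {u} u∈Sᵢ with u FinP.≟ v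
    ... | yes refl = Product.map₂ (λ root-obs _ → root-obs) (v∈Sᵢ⇒observed u∈Sᵢ)
    ... | no  u≢v  = dom (Sᵢ-v⊆S u∈Sᵢ u≢v) , λ u≡v → contradiction u≡v u≢v
    nbr-case : ∀ {u w} → u ∈ Sᵢ → w ∈ W i → E T u w → P w
    nbr-case {u} u∈Sᵢ w∈W e with u FinP.≟ v
    ... | yes refl = from-v w∈W e (proj₂ (v∈Sᵢ⇒observed u∈Sᵢ))
    ... | no  u≢v  = nbr (Sᵢ-v⊆S u∈Sᵢ u≢v) ∈⊤ e ,
      λ { refl → subst (Obs ⊤ S) (adjacent-to-v⇒root (Sᵢ⊆W u∈Sᵢ) e) (dom (Sᵢ-v⊆S u∈Sᵢ u≢v)) }
    prop-case : PropagationClosed T (W i) P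
    prop-case u∈W (u-obs , u≡v⇒root-obs) w∈W e others with ∈W⁻ u∈W
    ... | inj₂ refl = from-v w∈W e (u≡v⇒root-obs refl)
    ... | inj₁ u∈V  =
      prop ∈⊤ u-obs ∈⊤ e (λ x _ ex x≢w → proj₁ (others x (V-neighbour∈W u∈V ex) ex x≢w)) ,
      λ { refl → subst (Obs ⊤ S) (adjacent-to-v⇒root u∈W e) u-obs }

  powerDominates-W⇒observes : ∀ {i Sᵢ S} → Sᵢ ⊆ S → PD (W i) Sᵢ → ∀ {u} → u ∈ W i → Obs ⊤ S u
  powerDominates-W⇒observes {i} Sᵢ⊆S (Sᵢ⊆W , Sᵢ-observes) u∈W =
    observed-in-W⇒observed Sᵢ⊆W (λ u∈Sᵢ _ → Sᵢ⊆S u∈Sᵢ)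
      (λ v∈Sᵢ → dom (Sᵢ⊆S v∈Sᵢ) , nbr (Sᵢ⊆S v∈Sᵢ) ∈⊤ (root-adj i)) (Sᵢ-observes _ u∈W)

  add-v : ∀ {i D} → PD (V i) D → PD (W i) (D ∪ ⁅ v ⁆)
  add-v {i} {D} (D⊆V , D-observes) = D∪v⊆W , observes
    where
    v-obs : Obs (W i) (D ∪ ⁅ v ⁆) v
    v-obs = dom (x∈p∪q⁺ (inj₂ (x∈⁅x⁆ v)))
    D∪v⊆W : D ∪ ⁅ v ⁆ ⊆ W i
    D∪v⊆W u∈D∪v with x∈p∪q⁻ D ⁅ v ⁆ u∈D∪v
    ... | inj₁ u∈D = V⊆W (D⊆V u∈D)
    ... | inj₂ u∈⁅v⁆ = x∈p∪q⁺ (inj₂ u∈⁅v⁆)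
    observes : ∀ u → u ∈ W i → Obs (W i) (D ∪ ⁅ v ⁆) u
    observes u u∈W with ∈W⁻ u∈W
    ... | inj₁ u∈V = observed-in-V⇒observed V⊆W (p⊆p∪q ⁅ v ⁆) v-obs (D-observes u u∈V)
    ... | inj₂ refl = v-obs

  restrict-to-branch : ∀ {S} i → PD ⊤ S → PD (W i) (S ∩ V i ∪ ⁅ v ⁆)
  restrict-to-branch {S} i (_ , S-observes) =
    Sᵢ⊆W , λ u u∈W → Observed-ind T P dom-case nbr-case prop-case (S-observes u ∈⊤) u∈W
    where
    Sᵢ : Subset n
    Sᵢ = S ∩ V i ∪ ⁅ v ⁆
    P : Fin n → Set
    P u = u ∈ W i → Obs (W i) Sᵢ u
    v∈Sᵢ : v ∈ Sᵢ
    v∈Sᵢ = x∈p∪q⁺ (inj₂ (x∈⁅x⁆ v))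
    Sᵢ⊆W : Sᵢ ⊆ W i
    Sᵢ⊆W u∈Sᵢ with x∈p∪q⁻ (S ∩ V i) ⁅ v ⁆ u∈Sᵢ
    ... | inj₁ u∈S∩V = V⊆W (proj₂ (x∈p∩q⁻ S (V i) u∈S∩V))
    ... | inj₂ u∈⁅v⁆ = x∈p∪q⁺ (inj₂ u∈⁅v⁆)
    S∩W⊆Sᵢ : ∀ {u} → u ∈ S → u ∈ W i → u ∈ Sᵢ
    S∩W⊆Sᵢ u∈S u∈W with ∈W⁻ u∈W
    ... | inj₁ u∈V = x∈p∪q⁺ (inj₁ (x∈p∩q⁺ (u∈S , u∈V)))
    ... | inj₂ refl = v∈Sᵢ
    dom-case : ∀ {u} → u ∈ S → P u
    dom-case u∈S u∈W = dom (S∩W⊆Sᵢ u∈S u∈W)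
    nbr-case : ∀ {u w} → u ∈ S → w ∈ ⊤ → E T u w → P w
    nbr-case u∈S _ e w∈W with ∈W⁻ w∈W
    ... | inj₂ refl = dom v∈Sᵢ
    ... | inj₁ w∈V  = nbr (S∩W⊆Sᵢ u∈S (V-neighbour∈W w∈V (E-sym T e))) w∈W e
    prop-case : PropagationClosed T ⊤ P
    prop-case _ u-obs _ e others w∈W with ∈W⁻ w∈W
    ... | inj₂ refl = dom v∈Sᵢ
    ... | inj₁ w∈V with ∈W⁻ (V-neighbour∈W w∈V (E-sym T e))
    ...   | inj₂ refl = nbr v∈Sᵢ w∈W e
    ...   | inj₁ u∈V  =
      prop (V⊆W u∈V) (u-obs (V⊆W u∈V)) w∈W e (λ x x∈W ex x≢w → others x ∈⊤ ex x≢w x∈W)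

  observes-v⇒observes-root : ∀ {i Sᵢ} → Sᵢ ⊆ W i → Obs (W i) Sᵢ v → Obs (W i) Sᵢ (root i)
  observes-v⇒observes-root {i} {Sᵢ} Sᵢ⊆W v-obs =
    proj₂ (Observed-ind T P dom-case nbr-case prop-case v-obs) refl
    where
    P : Fin n → Set
    P u = Obs (W i) Sᵢ u × (u ≡ v → Obs (W i) Sᵢ (root i))
    dom-case : ∀ {u} → u ∈ Sᵢ → P u
    dom-case u∈Sᵢ = dom u∈Sᵢ , λ { refl → nbr u∈Sᵢ (V⊆W (root∈V i)) (root-adj i) }
    nbr-case : ∀ {u w} → u ∈ Sᵢ → w ∈ W i → E T u w → P w
    nbr-case u∈Sᵢ w∈W e =
      nbr u∈Sᵢ w∈W e , λ { refl → subst (Obs (W i) Sᵢ) (adjacent-to-v⇒root (Sᵢ⊆W u∈Sᵢ) e) (dom u∈Sᵢ) }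
    prop-case : PropagationClosed T (W i) P
    prop-case u∈W (u-obs , _) w∈W e others =
      prop u∈W u-obs w∈W e (λ x x∈W ex x≢w → proj₁ (others x x∈W ex x≢w)) ,
      λ { refl → subst (Obs (W i) Sᵢ) (adjacent-to-v⇒root u∈W e) u-obs }

  module _ {S} (S-pd : PD ⊤ S) (v∉S : v ∉ S) where

    S∩V : Fin k → Subset n
    S∩V i = S ∩ V i

    private
      S≢v : ∀ {u} → u ∈ S → u ≢ v
      S≢v u∈S refl = v∉S u∈S

      ∈S∩V : ∀ {u i} → u ∈ S → u ∈ V i → u ∈ S∩V i
      ∈S∩V u∈S u∈V = x∈p∩q⁺ (u∈S , u∈V)

    -- The observation of T by S, cut down to the components in A, each viewed in U i
    -- (which is T_i or T_i - v); only the step from v to a root needs outside help.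
    observed⇒observed-in-components : (A : Fin k → Set) (U : Fin k → Subset n) →
      (∀ {i} → V i ⊆ U i) → (∀ {i} → U i ⊆ W i) →
      (∀ i → A i → v ∈ U i → Obs (U i) (S∩V i) v) →
      (∀ i → A i → (∀ j → A j → j ≢ i → Obs (U j) (S∩V j) (root j)) → Obs (U i) (S∩V i) (root i)) →
      ∀ i → A i → ∀ {u} → u ∈ V i → Obs (U i) (S∩V i) u
    observed⇒observed-in-components A U V⊆U U⊆W v-obs root-obs i Aᵢ {u} u∈V =
      Observed-ind T P dom-case nbr-case prop-case (proj₂ S-pd u ∈⊤) i Aᵢ u∈V
      where
      P : Fin n → Set
      P u = ∀ i → A i → u ∈ V i → Obs (U i) (S∩V i) u
      dom-case : ∀ {u} → u ∈ S → P u
      dom-case u∈S _ _ u∈V = dom (∈S∩V u∈S u∈V)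
      nbr-case : ∀ {u w} → u ∈ S → w ∈ ⊤ → E T u w → P w
      nbr-case u∈S _ e _ _ w∈V =
        nbr (∈S∩V u∈S (V-neighbour∈V w∈V (E-sym T e) (S≢v u∈S))) (V⊆U w∈V) e
      prop-case : PropagationClosed T ⊤ P
      prop-case {u} {w} _ u-obs _ e others i Aᵢ w∈V with ∈W⁻ (V-neighbour∈W w∈V (E-sym T e))
      ... | inj₂ refl =
        subst (Obs (U i) (S∩V i)) (sym (v-neighbour≡root (V⊆W w∈V) e)) (root-obs i Aᵢ other-roots)
        where
        other-roots : ∀ j → A j → j ≢ i → Obs (U j) (S∩V j) (root j)
        other-roots j Aⱼ j≢i = others (root j) ∈⊤ (root-adj j) root≢w j Aⱼ (root∈V j)
          where
          root≢w : root j ≢ w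
          root≢w root≡w =
            j≢i (trans (sym (root-component j)) (trans (cong c root≡w) (proj₂ (∈V⁻ w∈V))))
      ... | inj₁ u∈V = prop (V⊆U u∈V) (u-obs i Aᵢ u∈V) (V⊆U w∈V) e others′
        where
        others′ : ∀ x → x ∈ U i → E T u x → x ≢ w → Obs (U i) (S∩V i) x
        others′ x x∈U ex x≢w with ∈W⁻ (U⊆W x∈U)
        ... | inj₁ x∈V = others x ∈⊤ ex x≢w i Aᵢ x∈V
        ... | inj₂ refl = v-obs i Aᵢ x∈U

    observes-v⇒powerDominates : ∀ {j} → Obs (W j) (S∩V j) v → PD (W j) (S∩V j)
    observes-v⇒powerDominates {j} v-obs = S∩V⊆W , observes
      where
      S∩V⊆W : S∩V j ⊆ W j
      S∩V⊆W = V⊆W ∘ p∩q⊆q S (V j)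
      observes : ∀ u → u ∈ W j → Obs (W j) (S∩V j) u
      observes u u∈W with ∈W⁻ u∈W
      ... | inj₂ refl = v-obs
      ... | inj₁ u∈V  = observed⇒observed-in-components (_≡ j) W V⊆W id
        (λ { _ refl _ → v-obs }) (λ { _ refl _ → observes-v⇒observes-root S∩V⊆W v-obs }) j refl u∈V

    some-component-observes-v : ¬ (∀ j → ¬ Obs (W j) (S∩V j) v)
    some-component-observes-v none =
      proj₁ (Observed-ind T P dom-case nbr-case prop-case (proj₂ S-pd v ∈⊤)) refl
      where
      P : Fin n → Set
      P u = u ≢ v × (∀ j → u ∈ V j → Obs (W j) (S∩V j) u)
      dom-case : ∀ {u} → u ∈ S → P u
      dom-case u∈S = S≢v u∈S , λ _ u∈V → dom (∈S∩V u∈S u∈V)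
      nbr-case : ∀ {u w} → u ∈ S → w ∈ ⊤ → E T u w → P w
      nbr-case {u} {w} u∈S _ e with w FinP.≟ v
      ... | yes refl = contradiction (nbr (∈S∩V u∈S (∈V-own (S≢v u∈S))) v∈W e) (none (c u))
      ... | no  w≢v  =
        w≢v , λ _ w∈V → nbr (∈S∩V u∈S (V-neighbour∈V w∈V (E-sym T e) (S≢v u∈S))) (V⊆W w∈V) e
      prop-case : PropagationClosed T ⊤ P
      prop-case {u} {w} _ (u≢v , u-obs) _ e others with w FinP.≟ v
      ... | yes refl = contradiction (prop (V⊆W u∈V) (u-obs (c u) u∈V) v∈W e others′) (none (c u))
        where
        u∈V : u ∈ V (c u)
        u∈V = ∈V-own u≢v
        others′ : ∀ x → x ∈ W (c u) → E T u x → x ≢ v → Obs (W (c u)) (S∩V (c u)) x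
        others′ x _ ex x≢v = proj₂ (others x ∈⊤ ex x≢v) (c u) (V-neighbour∈V u∈V ex x≢v)
      ... | no  w≢v  = w≢v , λ j w∈V → let u∈V = V-neighbour∈V w∈V (E-sym T e) u≢v in
        prop (V⊆W u∈V) (u-obs j u∈V) (V⊆W w∈V) e (others′ j u∈V)
        where
        others′ : ∀ j → u ∈ V j → ∀ x → x ∈ W j → E T u x → x ≢ w → Obs (W j) (S∩V j) x
        others′ j _ x x∈W ex x≢w with ∈W⁻ x∈W
        ... | inj₁ x∈V = proj₂ (others x ∈⊤ ex x≢w) j x∈V
        ... | inj₂ refl = contradiction refl (proj₁ (others v ∈⊤ ex x≢w))

    some-component-powerDominated : ¬ (∀ j → ¬ PD (W j) (S∩V j))
    some-component-powerDominated none =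
      some-component-observes-v (λ j v-obs → none j (observes-v⇒powerDominates v-obs))

    observes-root⇒powerDominates-V : ∀ {i} → Obs (V i) (S∩V i) (root i) → PD (V i) (S∩V i)
    observes-root⇒powerDominates-V {i} root-obs = p∩q⊆q S (V i) , λ u u∈V →
      observed⇒observed-in-components (_≡ i) V id V⊆W
        (λ _ _ v∈V → contradiction refl (proj₁ (∈V⁻ v∈V))) (λ { _ refl _ → root-obs }) i refl u∈V

    -- Propagation out of v reaches the root of one component only after the roots of all
    -- the others are observed.
    at-most-one-V-not-powerDominated : ∀ {i j} → i ≢ j →
      ¬ PD (V i) (S∩V i) → ¬ PD (V j) (S∩V j) → Empty
    at-most-one-V-not-powerDominated {i} {j} i≢j ¬pdᵢ ¬pdⱼ =
      ¬pdᵢ (p∩q⊆q S (V i) , λ u u∈V →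
        observed⇒observed-in-components A V id V⊆W
          (λ _ _ v∈V → contradiction refl (proj₁ (∈V⁻ v∈V))) root-obs i (inj₁ refl) u∈V)
      where
      A : Fin k → Set
      A t = t ≡ i ⊎ t ≡ j
      root-obs : ∀ t → A t → (∀ t′ → A t′ → t′ ≢ t → Obs (V t′) (S∩V t′) (root t′)) →
                 Obs (V t) (S∩V t) (root t)
      root-obs _ (inj₁ refl) others =
        contradiction (others j (inj₂ refl) (i≢j ∘ sym)) (¬pdⱼ ∘ observes-root⇒powerDominates-V)
      root-obs _ (inj₂ refl) others =
        contradiction (others i (inj₁ refl) i≢j) (¬pdᵢ ∘ observes-root⇒powerDominates-V)

  module _ {U X m} (γ : IsGammaP T U X m) where

    optimal : Subset n
    optimal = proj₁ (proj₁ γ)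

    optimal-⊇ : X ⊆ optimal
    optimal-⊇ = proj₁ (proj₂ (proj₁ γ))

    optimal-pd : PD U optimal
    optimal-pd = proj₁ (proj₂ (proj₂ (proj₁ γ)))

    optimal-size : ∣ optimal ∣ ≡ m
    optimal-size = proj₂ (proj₂ (proj₂ (proj₁ γ)))

    optimal-minimal : ∀ {S} → X ⊆ S → PD U S → m ≤ ∣ S ∣
    optimal-minimal {S} = proj₂ γ S

  module Bounds (a b d : Fin k → ℕ)
    (ha : ∀ i → IsGammaP T (W i) ⁅ v ⁆ (a i))
    (hb : ∀ i → IsGammaP T (W i) ⊥ (b i))
    (hd : ∀ i → IsGammaP T (V i) ⊥ (d i))
    (m : ℕ) (hm : IsGammaP T ⊤ ⊥ m) where

    Sa Sb Sd : Fin k → Subset n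
    Sa i = optimal (ha i)
    Sb i = optimal (hb i)
    Sd i = optimal (hd i)

    ∈setI⁺ : ∀ {i} → a i ≡ b i → suc (d i) ≢ a i → i ∈ setI a b d
    ∈setI⁺ {i} aᵢ≡bᵢ 1+dᵢ≢aᵢ =
      ∈-tabulate⁺ (cong₂ _∧_ (dec-true (a i ≟ b i) aᵢ≡bᵢ)
                             (cong not (dec-false (suc (d i) ≟ a i) 1+dᵢ≢aᵢ)))

    ∈setI⁻ : ∀ {i} → i ∈ setI a b d → a i ≡ b i × suc (d i) ≢ a i
    ∈setI⁻ {i} i∈I =
      does⇒ (a i ≟ b i) (∧-conicalˡ _ _ i∈I′) , not-does⇒ (suc (d i) ≟ a i) (∧-conicalʳ _ _ i∈I′)
      where i∈I′ = ∈-tabulate⁻ i∈I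

    ∈setJ⁺ : ∀ {i} → a i ≢ b i → i ∈ setJ a b
    ∈setJ⁺ {i} aᵢ≢bᵢ = ∈-tabulate⁺ (cong not (dec-false (a i ≟ b i) aᵢ≢bᵢ))

    ∈setJ⁻ : ∀ {i} → i ∈ setJ a b → a i ≢ b i
    ∈setJ⁻ {i} i∈J = not-does⇒ (a i ≟ b i) (∈-tabulate⁻ i∈J)

    b≤a : ∀ i → b i ≤ a i
    b≤a i = subst (b i ≤_) (optimal-size (ha i)) (optimal-minimal (hb i) ⊥⊆ (optimal-pd (ha i)))

    a≤1+d : ∀ i → a i ≤ suc (d i)
    a≤1+d i = begin
      a i               ≤⟨ optimal-minimal (ha i) (q⊆p∪q (Sd i) ⁅ v ⁆) (add-v (optimal-pd (hd i))) ⟩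
      ∣ Sd i ∪ ⁅ v ⁆ ∣  ≤⟨ ∣p∪⁅x⁆∣≤1+∣p∣ (Sd i) v ⟩
      suc ∣ Sd i ∣      ≡⟨ cong suc (optimal-size (hd i)) ⟩
      suc (d i)         ∎
      where open ≤-Reasoning

    ∣Sa-v∣<a : ∀ i → ∣ Sa i - v ∣ < a i
    ∣Sa-v∣<a i =
      subst (∣ Sa i - v ∣ <_) (optimal-size (ha i)) (x∈p⇒∣p-x∣<∣p∣ (optimal-⊇ (ha i) (x∈⁅x⁆ v)))

    upper-bound : m + k ≤ sumF a + 1
    upper-bound = begin
      m + k                            ≤⟨ +-monoˡ-≤ k (optimal-minimal hm ⊥⊆ S₁-pd) ⟩
      ∣ S₁ ∣ + k                       ≤⟨ +-monoˡ-≤ k (∣p∪q∣≤∣p∣+∣q∣ ⁅ v ⁆ _) ⟩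
      ∣ ⁅ v ⁆ ∣ + ∣ ⋃ᶠ Sa-v ∣ + k      ≡⟨ cong (λ z → z + ∣ ⋃ᶠ Sa-v ∣ + k) (∣⁅x⁆∣≡1 v) ⟩
      suc ∣ ⋃ᶠ Sa-v ∣ + k              ≤⟨ +-monoˡ-≤ k (s≤s (∣⋃ᶠ∣≤sumF Sa-v)) ⟩
      suc (sumF (∣_∣ ∘ Sa-v)) + k      ≡⟨ cong suc (+-comm (sumF (∣_∣ ∘ Sa-v)) k) ⟩
      suc (k + sumF (∣_∣ ∘ Sa-v))      ≡⟨ cong suc (sumF-suc (∣_∣ ∘ Sa-v)) ⟨
      suc (sumF (suc ∘ ∣_∣ ∘ Sa-v))    ≤⟨ s≤s (sumF-mono-≤ ∣Sa-v∣<a) ⟩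
      suc (sumF a)                     ≡⟨ +-comm 1 (sumF a) ⟩
      sumF a + 1                       ∎
      where
      open ≤-Reasoning
      Sa-v : Fin k → Subset n
      Sa-v i = Sa i - v
      S₁ : Subset n
      S₁ = ⁅ v ⁆ ∪ ⋃ᶠ Sa-v
      Sa⊆S₁ : ∀ {i} → Sa i ⊆ S₁
      Sa⊆S₁ {i} {u} u∈Sa with u FinP.≟ v
      ... | yes refl = x∈p∪q⁺ (inj₁ (x∈⁅x⁆ v))
      ... | no  u≢v  = x∈p∪q⁺ (inj₂ (∈⋃ᶠ⁺ Sa-v i (x∈p∧x≢y⇒x∈p-y u∈Sa u≢v)))
      S₁-pd : PD ⊤ S₁
      S₁-pd = ⊆⊤ , observes
        where
        observes : ∀ u → u ∈ ⊤ → Obs ⊤ S₁ u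
        observes u _ with u FinP.≟ v
        ... | yes refl = dom (x∈p∪q⁺ (inj₁ (x∈⁅x⁆ v)))
        ... | no  u≢v  = powerDominates-W⇒observes Sa⊆S₁ (optimal-pd (ha (c u))) (V⊆W (∈V-own u≢v))

    data Kind (i : Fin k) : Set where
      J-kind  : a i ≢ b i → Kind i
      I′-kind : a i ≡ b i → suc (d i) ≡ a i → Kind i
      I-kind  : a i ≡ b i → suc (d i) ≢ a i → Kind i

    kind : ∀ i → Kind i
    kind i with a i ≟ b i | suc (d i) ≟ a i
    ... | no  aᵢ≢bᵢ | _            = J-kind aᵢ≢bᵢ
    ... | yes aᵢ≡bᵢ | yes 1+dᵢ≡aᵢ = I′-kind aᵢ≡bᵢ 1+dᵢ≡aᵢ
    ... | yes aᵢ≡bᵢ | no  1+dᵢ≢aᵢ = I-kind aᵢ≡bᵢ 1+dᵢ≢aᵢ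

    chosen : ∀ {i} → Kind i → Subset n
    chosen {i} (J-kind _)    = Sb i
    chosen {i} (I′-kind _ _) = Sd i
    chosen {i} (I-kind _ _)  = Sa i - v

    chosen-size : ∀ {i} (κ : Kind i) → ∣ chosen κ ∣ < a i
    chosen-size {i} (J-kind aᵢ≢bᵢ) =
      subst (_< a i) (sym (optimal-size (hb i))) (≤∧≢⇒< (b≤a i) (aᵢ≢bᵢ ∘ sym))
    chosen-size {i} (I′-kind _ 1+dᵢ≡aᵢ) =
      ≤-reflexive (trans (cong suc (optimal-size (hd i))) 1+dᵢ≡aᵢ)
    chosen-size {i} (I-kind _ _) = ∣Sa-v∣<a i

    module _ (∣I∣≤1 : ∣ setI a b d ∣ ≤ 1) (0<∣J∣ : 0 < ∣ setJ a b ∣) where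

      S₂ : Subset n
      S₂ = ⋃ᶠ (chosen ∘ kind)

      chosen⊆S₂ : ∀ i → chosen (kind i) ⊆ S₂
      chosen⊆S₂ i = ∈⋃ᶠ⁺ (chosen ∘ kind) i

      v-observed : Obs ⊤ S₂ v
      v-observed = from-J j₀ (kind j₀) (∈setJ⁻ j₀∈J) (chosen⊆S₂ j₀)
        where
        J-nonempty : Nonempty (setJ a b)
        J-nonempty = 0<∣p∣⇒Nonempty {p = setJ a b} 0<∣J∣
        j₀ = proj₁ J-nonempty
        j₀∈J = proj₂ J-nonempty
        from-J : ∀ i (κ : Kind i) → a i ≢ b i → chosen κ ⊆ S₂ → Obs ⊤ S₂ v
        from-J i (J-kind _)        _     ⊆S₂ = powerDominates-W⇒observes ⊆S₂ (optimal-pd (hb i)) v∈W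
        from-J i (I′-kind aᵢ≡bᵢ _) aᵢ≢bᵢ _   = contradiction aᵢ≡bᵢ aᵢ≢bᵢ
        from-J i (I-kind aᵢ≡bᵢ _)  aᵢ≢bᵢ _   = contradiction aᵢ≡bᵢ aᵢ≢bᵢ

      V-observed-outside-I : ∀ i (κ : Kind i) → i ∉ setI a b d → chosen κ ⊆ S₂ →
                             ∀ {u} → u ∈ V i → Obs ⊤ S₂ u
      V-observed-outside-I i (J-kind _)    _ ⊆S₂ u∈V =
        powerDominates-W⇒observes ⊆S₂ (optimal-pd (hb i)) (V⊆W u∈V)
      V-observed-outside-I i (I′-kind _ _) _ ⊆S₂ u∈V =
        observed-in-V⇒observed ⊆⊤ ⊆S₂ v-observed (proj₂ (optimal-pd (hd i)) _ u∈V)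
      V-observed-outside-I i (I-kind aᵢ≡bᵢ 1+dᵢ≢aᵢ) i∉I _ _ =
        contradiction (∈setI⁺ aᵢ≡bᵢ 1+dᵢ≢aᵢ) i∉I

      -- Every other neighbour of v lies in a component outside I, hence is already observed.
      root-observed-in-I : ∀ {i} → i ∈ setI a b d → Obs ⊤ S₂ (root i)
      root-observed-in-I {i} i∈I = prop ∈⊤ v-observed ∈⊤ (root-adj i) others
        where
        others : ∀ y → y ∈ ⊤ → E T v y → y ≢ root i → Obs ⊤ S₂ y
        others y _ e y≢root =
          V-observed-outside-I (c y) (kind (c y)) cy∉I (chosen⊆S₂ (c y)) (∈V-own y≢v)
          where
          y≢v : y ≢ v
          y≢v refl = E-irrefl T e
          cy∉I : c y ∉ setI a b d
          cy∉I cy∈I = y≢root (v-neighbour≡root (V⊆W (∈V⁺ y≢v (∣p∣≤1⇒∈-unique ∣I∣≤1 cy∈I i∈I))) e)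

      V-observed-in-I : ∀ i (κ : Kind i) → i ∈ setI a b d → chosen κ ⊆ S₂ →
                        ∀ {u} → u ∈ V i → Obs ⊤ S₂ u
      V-observed-in-I i (J-kind aᵢ≢bᵢ)     i∈I _ _ = contradiction (proj₁ (∈setI⁻ i∈I)) aᵢ≢bᵢ
      V-observed-in-I i (I′-kind _ 1+dᵢ≡aᵢ) i∈I _ _ = contradiction 1+dᵢ≡aᵢ (proj₂ (∈setI⁻ i∈I))
      V-observed-in-I i (I-kind _ _)        i∈I ⊆S₂ u∈V =
        observed-in-W⇒observed (proj₁ (optimal-pd (ha i))) (λ u∈Sa u≢v → ⊆S₂ (x∈p∧x≢y⇒x∈p-y u∈Sa u≢v))
          (λ _ → v-observed , root-observed-in-I i∈I) (proj₂ (optimal-pd (ha i)) _ (V⊆W u∈V))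

      S₂-pd : PD ⊤ S₂
      S₂-pd = ⊆⊤ , observes
        where
        observes : ∀ u → u ∈ ⊤ → Obs ⊤ S₂ u
        observes u _ with u FinP.≟ v
        ... | yes refl = v-observed
        ... | no  u≢v with c u ∈? setI a b d
        ...   | yes cu∈I =
          V-observed-in-I (c u) (kind (c u)) cu∈I (chosen⊆S₂ (c u)) (∈V-own u≢v)
        ...   | no  cu∉I =
          V-observed-outside-I (c u) (kind (c u)) cu∉I (chosen⊆S₂ (c u)) (∈V-own u≢v)

      upper-bound-I≤1-J≥1 : m + k ≤ sumF a
      upper-bound-I≤1-J≥1 = begin
        m + k                              ≤⟨ +-monoˡ-≤ k (optimal-minimal hm ⊥⊆ S₂-pd) ⟩
        ∣ S₂ ∣ + k                         ≤⟨ +-monoˡ-≤ k (∣⋃ᶠ∣≤sumF (chosen ∘ kind)) ⟩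
        sumF (∣_∣ ∘ chosen ∘ kind) + k     ≡⟨ +-comm _ k ⟩
        k + sumF (∣_∣ ∘ chosen ∘ kind)     ≡⟨ sumF-suc (∣_∣ ∘ chosen ∘ kind) ⟨
        sumF (suc ∘ ∣_∣ ∘ chosen ∘ kind)   ≤⟨ sumF-mono-≤ (chosen-size ∘ kind) ⟩
        sumF a                             ∎
        where open ≤-Reasoning

    S : Subset n
    S = optimal hm

    s : Fin k → ℕ
    s i = ∣ S ∩ V i ∣

    a≤1+s : ∀ i → a i ≤ suc (s i)
    a≤1+s i = ≤-trans (optimal-minimal (ha i) (q⊆p∪q (S ∩ V i) ⁅ v ⁆) (restrict-to-branch i (optimal-pd hm)))
                      (∣p∪⁅x⁆∣≤1+∣p∣ (S ∩ V i) v)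

    sumF-a≤k+sumF-s : sumF a ≤ k + sumF s
    sumF-a≤k+sumF-s = ≤-trans (sumF-mono-≤ a≤1+s) (≤-reflexive (sumF-suc s))

    sumF-s≡∣⋃S∩V∣ : sumF s ≡ ∣ ⋃ᶠ (λ i → S ∩ V i) ∣
    sumF-s≡∣⋃S∩V∣ = sym (∣⋃ᶠ∣≡sumF (λ i → S ∩ V i) disjoint)
      where
      disjoint : ∀ {i j u} → u ∈ S ∩ V i → u ∈ S ∩ V j → i ≡ j
      disjoint {i} {j} u∈S∩Vᵢ u∈S∩Vⱼ =
        trans (sym (proj₂ (∈V⁻ (p∩q⊆q S (V i) u∈S∩Vᵢ)))) (proj₂ (∈V⁻ (p∩q⊆q S (V j) u∈S∩Vⱼ)))

    sumF-s≤m : sumF s ≤ m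
    sumF-s≤m = begin
      sumF s                    ≡⟨ sumF-s≡∣⋃S∩V∣ ⟩
      ∣ ⋃ᶠ (λ i → S ∩ V i) ∣    ≤⟨ p⊆q⇒∣p∣≤∣q∣ ⋃⊆S ⟩
      ∣ S ∣                     ≡⟨ optimal-size hm ⟩
      m                         ∎
      where
      open ≤-Reasoning
      ⋃⊆S : ⋃ᶠ (λ i → S ∩ V i) ⊆ S
      ⋃⊆S u∈⋃ = p∩q⊆p S _ (proj₂ (∈⋃ᶠ⁻ (λ i → S ∩ V i) u∈⋃))

    v∈S⇒sumF-s<m : v ∈ S → sumF s < m
    v∈S⇒sumF-s<m v∈S = begin-strict
      sumF s                    ≡⟨ sumF-s≡∣⋃S∩V∣ ⟩
      ∣ ⋃ᶠ (λ i → S ∩ V i) ∣    ≤⟨ p⊆q⇒∣p∣≤∣q∣ ⋃⊆S-v ⟩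
      ∣ S - v ∣                 <⟨ x∈p⇒∣p-x∣<∣p∣ v∈S ⟩
      ∣ S ∣                     ≡⟨ optimal-size hm ⟩
      m                         ∎
      where
      open ≤-Reasoning
      ⋃⊆S-v : ⋃ᶠ (λ i → S ∩ V i) ⊆ S - v
      ⋃⊆S-v u∈⋃ =
        let (i , u∈S∩V) = ∈⋃ᶠ⁻ (λ i → S ∩ V i) u∈⋃
            (u∈S , u∈V) = x∈p∩q⁻ S (V i) u∈S∩V
        in x∈p∧x≢y⇒x∈p-y u∈S (proj₁ (∈V⁻ u∈V))

    lower-bound : sumF a ≤ m + k
    lower-bound = begin
      sumF a      ≤⟨ sumF-a≤k+sumF-s ⟩
      k + sumF s  ≤⟨ +-monoʳ-≤ k sumF-s≤m ⟩
      k + m       ≡⟨ +-comm k m ⟩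
      m + k       ∎
      where open ≤-Reasoning

    -- With s i < a i, no S ∩ V i power dominates T_i (it would give b i ≤ s i, so i ∈ J), and
    -- none with i ∈ I power dominates T_i - v (it would give a i = d i + 1).
    no-slack-impossible : v ∉ S → (2 ≤ ∣ setI a b d ∣ ⊎ ∣ setJ a b ∣ ≡ 0) → ¬ (∀ i → s i < a i)
    no-slack-impossible v∉S (inj₂ ∣J∣≡0) s<a =
      some-component-powerDominated (optimal-pd hm) v∉S λ j pdⱼ →
        let bⱼ<aⱼ = ≤-<-trans (optimal-minimal (hb j) ⊥⊆ pdⱼ) (s<a j)
            j∈J   = ∈setJ⁺ (λ aⱼ≡bⱼ → <⇒≢ bⱼ<aⱼ (sym aⱼ≡bⱼ))
        in contradiction (subst (0 <_) ∣J∣≡0 (x∈p⇒0<∣p∣ j∈J)) λ ()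
    no-slack-impossible v∉S (inj₁ 2≤∣I∣) s<a =
      contradiction (≤-trans 2≤∣I∣ (∈-unique⇒∣p∣≤1 I-unique)) λ { (s≤s ()) }
      where
      ¬pd : ∀ {i} → i ∈ setI a b d → ¬ PD (V i) (S ∩ V i)
      ¬pd {i} i∈I pdᵢ = proj₂ (∈setI⁻ i∈I)
        (≤-antisym (≤-<-trans (optimal-minimal (hd i) ⊥⊆ pdᵢ) (s<a i)) (a≤1+d i))
      I-unique : ∀ {i j} → i ∈ setI a b d → j ∈ setI a b d → i ≡ j
      I-unique {i} {j} i∈I j∈I with i FinP.≟ j
      ... | yes i≡j = i≡j
      ... | no  i≢j = contradiction (¬pd j∈I)
                        (at-most-one-V-not-powerDominated (optimal-pd hm) v∉S i≢j (¬pd i∈I))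

    lower-bound-strict : (2 ≤ ∣ setI a b d ∣ ⊎ ∣ setJ a b ∣ ≡ 0) → sumF a + 1 ≤ m + k
    lower-bound-strict cond with v ∈? S
    ... | yes v∈S = begin
      sumF a + 1         ≤⟨ +-monoˡ-≤ 1 sumF-a≤k+sumF-s ⟩
      k + sumF s + 1     ≡⟨ +-assoc k (sumF s) 1 ⟩
      k + (sumF s + 1)   ≡⟨ cong (k +_) (+-comm (sumF s) 1) ⟩
      k + suc (sumF s)   ≤⟨ +-monoʳ-≤ k (v∈S⇒sumF-s<m v∈S) ⟩
      k + m              ≡⟨ +-comm k m ⟩
      m + k              ∎
      where open ≤-Reasoning
    ... | no v∉S with FinP.any? (λ j → a j ≤? s j)
    ...   | yes (j , aⱼ≤sⱼ) = begin
      sumF a + 1         ≡⟨ +-comm (sumF a) 1 ⟩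
      suc (sumF a)       ≤⟨ sumF-mono-< a≤1+s j (s≤s aⱼ≤sⱼ) ⟩
      sumF (suc ∘ s)     ≡⟨ sumF-suc s ⟩
      k + sumF s         ≤⟨ +-monoʳ-≤ k sumF-s≤m ⟩
      k + m              ≡⟨ +-comm k m ⟩
      m + k              ∎
      where open ≤-Reasoning
    ...   | no ∄slack = contradiction (λ i → ≰⇒> (∄slack ∘ (i ,_))) (no-slack-impossible v∉S cond)

theorem4p2 : ∀ {n : ℕ} (T : Graph n) → IsTree T → (v : Fin n) → 2 ≤ deg T v →
    (k : ℕ) (c : Fin n → Fin k) →
    (∀ i → Σ (Fin n) (λ u → u ≢ v × c u ≡ i)) →
    (∀ u w → u ≢ v → w ≢ v → (c u ≡ c w ⇔ Reach T (allBut v) u w)) →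
    (a b d : Fin k → ℕ) →
    (∀ i → IsGammaP T (classOf v c i ∪ ⁅ v ⁆) ⁅ v ⁆ (a i)) →
    (∀ i → IsGammaP T (classOf v c i ∪ ⁅ v ⁆) ⊥ (b i)) →
    (∀ i → IsGammaP T (classOf v c i) ⊥ (d i)) →
    (m : ℕ) → IsGammaP T ⊤ ⊥ m →
    ((2 ≤ ∣ setI a b d ∣ ⊎ ∣ setJ a b ∣ ≡ 0) → m + k ≡ sumF a + 1) ×
    ((∣ setI a b d ∣ ≤ 1 × 1 ≤ ∣ setJ a b ∣) → m + k ≡ sumF a)
theorem4p2 T tree v _ k c c-onto c-components a b d ha hb hd m hm =
  (λ cond → ≤-antisym upper-bound (lower-bound-strict cond)) ,
  (λ (∣I∣≤1 , 0<∣J∣) → ≤-antisym (upper-bound-I≤1-J≥1 ∣I∣≤1 0<∣J∣) lower-bound)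
  where open Branches.Bounds T tree v c c-onto c-components a b d ha hb hd m hm
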